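{- $$\sum_{n=1}^{\infty}\frac{6H_{n+1}^{(4)}+8H_{n+1}^{(3)}H_{n+1}+3(H_{n+1}^{(2)})^2+6(H_{n+1})^2H_{n+1}^{(2)}+(H_{n+1})^4}{n(n+1)}=5!.$$
   Context: For positive integers $\alpha$, $H_m^{(\alpha)}=\sum_{j=1}^{m}\frac{1}{j^\alpha}$ and $H_m=H_m^{(1)}$ is the $m$-th harmonic number. -}

module Defs where

open import Data.Nat as ℕ using (ℕ; zero; suc)
open import Data.Nat.Properties using (m^n≢0)
open import Data.Integer using (+_)
open import Data.Rational using (ℚ; 0ℚ; _+_; _*_; _/_)

H[_]_ : ℕ → ℕ → ℚ
H[ α ] zero = 0ℚ
H[ α ] suc m = H[ α ] m + _/_ (+ 1) (suc m ℕ.^ α) {{m^n≢0 (suc m) α}}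

H : ℕ → ℚ
H m = H[ 1 ] m

term : ℕ → ℚ
term k = numer * ((+ 1) / (n ℕ.* (n ℕ.+ 1)))
  where
  n = suc k
  m = n ℕ.+ 1
  h1 = H m
  h2 = H[ 2 ] m
  h3 = H[ 3 ] m
  h4 = H[ 4 ] m
  numer : ℚ
  numer = (+ 6 / 1) * h4 + (+ 8 / 1) * h3 * h1 + (+ 3 / 1) * h2 * h2
        + (+ 6 / 1) * h1 * h1 * h2 + h1 * h1 * h1 * h1

S : ℕ → ℚ
S zero = 0ℚ
S (suc k) = S k + term k

-- With x_j = 1/j, the numerator of the n-th summand is 4! h₄(x₁, …, x_{n+1}), where h_k is the
-- complete homogeneous symmetric polynomial (written through the power sums H^(α) by Newton's
-- identities). Let Φ(m) = 4! Σ_{k ≤ 4} h_k(x₁, …, x_m). The recursion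
-- h_k(x₁, …, x_{m+1}) = h_k(x₁, …, x_m) + x_{m+1} h_{k-1}(x₁, …, x_{m+1}) together with
-- 1/(n(n+1)) = 1/n - 1/(n+1) makes the partial sums telescope: S_N = 5! - Φ(N+1)/(N+1).
-- This tail is nonnegative, decreasing, and since H_{2^j} ≤ j + 1 it is at most a polynomial
-- in j divided by 2^j.

module Submission where

open import Defs
open import Data.Nat using (ℕ) renaming (_≤_ to _≤ℕ_)
open import Data.Integer using (+_)
open import Data.Rational using (ℚ; 0ℚ; _<_; _-_; ∣_∣; _/_)
open import Data.Product using (∃)

open import Data.Nat as ℕ using (zero; suc; NonZero; _^_)
import Data.Nat.Properties as ℕP
import Data.Nat.Solver as ℕS
open import Data.Fin using (Fin; toℕ; zero; suc)
import Data.Integer as ℤ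
import Data.Integer.Properties as ℤP
open import Data.Rational as Q using (1ℚ; _≤_; _+_; _*_; mkℚ; toℚᵘ; fromℚᵘ)
import Data.Rational.Properties as ℚP
import Data.Rational.Unnormalised as ℚᵘ
import Data.Rational.Unnormalised.Properties as ℚᵘP
open import Data.Rational.Solver using (module +-*-Solver)
open import Data.Vec.Functional using (_∷_; [])
open import Data.Product using (_×_; _,_; proj₁; proj₂)
open import Function using (id; _∘_)
open import Relation.Binary.PropositionalEquality

private
  variable
    n : ℕ

fromℕ : ℕ → ℚ
fromℕ n = + n / 1

1/ℕ : (n : ℕ) .{{_ : NonZero n}} → ℚ
1/ℕ n = + 1 / n

1/suc : ℕ → ℚ
1/suc m = 1/ℕ (suc m)

infixr 8 _^ℚ_
_^ℚ_ : ℚ → ℕ → ℚ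
x ^ℚ zero  = 1ℚ
x ^ℚ suc a = x * x ^ℚ a

fromℚᵘ-homo-+ : ∀ u v → fromℚᵘ (u ℚᵘ.+ v) ≡ fromℚᵘ u + fromℚᵘ v
fromℚᵘ-homo-+ u v = ℚP.toℚᵘ-injective (begin
  toℚᵘ (fromℚᵘ (u ℚᵘ.+ v))              ≈⟨ ℚP.toℚᵘ-fromℚᵘ (u ℚᵘ.+ v) ⟩
  u ℚᵘ.+ v                              ≈⟨ ℚᵘP.+-cong (ℚP.toℚᵘ-fromℚᵘ u) (ℚP.toℚᵘ-fromℚᵘ v) ⟨
  toℚᵘ (fromℚᵘ u) ℚᵘ.+ toℚᵘ (fromℚᵘ v)  ≈⟨ ℚP.toℚᵘ-homo-+ (fromℚᵘ u) (fromℚᵘ v) ⟨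
  toℚᵘ (fromℚᵘ u + fromℚᵘ v)            ∎)
  where open ℚᵘP.≃-Reasoning

fromℚᵘ-homo-* : ∀ u v → fromℚᵘ (u ℚᵘ.* v) ≡ fromℚᵘ u * fromℚᵘ v
fromℚᵘ-homo-* u v = ℚP.toℚᵘ-injective (begin
  toℚᵘ (fromℚᵘ (u ℚᵘ.* v))              ≈⟨ ℚP.toℚᵘ-fromℚᵘ (u ℚᵘ.* v) ⟩
  u ℚᵘ.* v                              ≈⟨ ℚᵘP.*-cong (ℚP.toℚᵘ-fromℚᵘ u) (ℚP.toℚᵘ-fromℚᵘ v) ⟨
  toℚᵘ (fromℚᵘ u) ℚᵘ.* toℚᵘ (fromℚᵘ v)  ≈⟨ ℚP.toℚᵘ-homo-* (fromℚᵘ u) (fromℚᵘ v) ⟨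
  toℚᵘ (fromℚᵘ u * fromℚᵘ v)            ∎)
  where open ℚᵘP.≃-Reasoning

fromℕ-homo-+ : ∀ a b → fromℕ (a ℕ.+ b) ≡ fromℕ a + fromℕ b
fromℕ-homo-+ a b = trans (ℚP.fromℚᵘ-cong {ℚᵘ.mkℚᵘ (+ (a ℕ.+ b)) 0} {a/1 ℚᵘ.+ b/1} (ℚᵘ.*≡* eq))
                         (fromℚᵘ-homo-+ a/1 b/1)
  where
  a/1 = ℚᵘ.mkℚᵘ (+ a) 0
  b/1 = ℚᵘ.mkℚᵘ (+ b) 0
  eq : + (a ℕ.+ b) ℤ.* + 1 ≡ (+ a ℤ.* + 1 ℤ.+ + b ℤ.* + 1) ℤ.* + 1
  eq = cong (ℤ._* + 1) (trans (ℤP.pos-+ a b)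
         (sym (cong₂ ℤ._+_ (ℤP.*-identityʳ (+ a)) (ℤP.*-identityʳ (+ b)))))

fromℕ-homo-* : ∀ a b → fromℕ (a ℕ.* b) ≡ fromℕ a * fromℕ b
fromℕ-homo-* a b = trans (ℚP.fromℚᵘ-cong {ℚᵘ.mkℚᵘ (+ (a ℕ.* b)) 0} {a/1 ℚᵘ.* b/1} (ℚᵘ.*≡* eq))
                         (fromℚᵘ-homo-* a/1 b/1)
  where
  a/1 = ℚᵘ.mkℚᵘ (+ a) 0
  b/1 = ℚᵘ.mkℚᵘ (+ b) 0
  eq : + (a ℕ.* b) ℤ.* + 1 ≡ (+ a ℤ.* + b) ℤ.* + 1
  eq = cong (ℤ._* + 1) (ℤP.pos-* a b)

1/ℕ-cong : ∀ {a b} .{{_ : NonZero a}} .{{_ : NonZero b}} → a ≡ b → 1/ℕ a ≡ 1/ℕ b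
1/ℕ-cong refl = refl

1/ℕ-homo-* : ∀ a b .{{_ : NonZero a}} .{{_ : NonZero b}} →
             1/ℕ (a ℕ.* b) {{ℕP.m*n≢0 a b}} ≡ 1/ℕ a * 1/ℕ b
1/ℕ-homo-* (suc a) (suc b) = fromℚᵘ-homo-* (ℚᵘ.mkℚᵘ (+ 1) a) (ℚᵘ.mkℚᵘ (+ 1) b)

1/ℕ-homo-^ : ∀ s a .{{_ : NonZero s}} → 1/ℕ (s ^ a) {{ℕP.m^n≢0 s a}} ≡ 1/ℕ s ^ℚ a
1/ℕ-homo-^ s zero    = refl
1/ℕ-homo-^ s (suc a) {{s≢0}} = trans (1/ℕ-homo-* s (s ^ a) {{s≢0}} {{ℕP.m^n≢0 s a}})
                                     (cong (1/ℕ s *_) (1/ℕ-homo-^ s a))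

fromℕ-*-1/suc : ∀ m → fromℕ (suc m) * 1/suc m ≡ 1ℚ
fromℕ-*-1/suc m = trans (sym (fromℚᵘ-homo-* [1+m]/1 1/[1+m]))
                        (ℚP.fromℚᵘ-cong {[1+m]/1 ℚᵘ.* 1/[1+m]} {ℚᵘ.mkℚᵘ (+ 1) 0} (ℚᵘ.*≡* eq))
  where
  [1+m]/1 = ℚᵘ.mkℚᵘ (+ suc m) 0
  1/[1+m] = ℚᵘ.mkℚᵘ (+ 1) m
  eq : (+ suc m ℤ.* + 1) ℤ.* + 1 ≡ + 1 ℤ.* + (1 ℕ.* suc m)
  eq = trans (ℤP.*-identityʳ _) (trans (ℤP.*-identityʳ _)
         (trans (cong +_ (sym (ℕP.*-identityˡ (suc m)))) (sym (ℤP.*-identityˡ _))))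

p≤p+q : ∀ {p q} → 0ℚ ≤ q → p ≤ p + q
p≤p+q {p} 0≤q = subst (_≤ p + _) (ℚP.+-identityʳ p) (ℚP.+-mono-≤ (ℚP.≤-refl {p}) 0≤q)

1/suc-nonNeg : ∀ m → 0ℚ ≤ 1/suc m
1/suc-nonNeg m = ℚP.nonNegative⁻¹ (1/suc m) {{ℚP.normalize-nonNeg 1 (suc m)}}

1/suc-antitone : ∀ {m n} → m ≤ℕ n → 1/suc n ≤ 1/suc m
1/suc-antitone {m} {n} m≤n = ℚP.toℚᵘ-cancel-≤
  (ℚᵘP.≤-respˡ-≃ (ℚᵘP.≃-sym (ℚP.toℚᵘ-fromℚᵘ (ℚᵘ.mkℚᵘ (+ 1) n)))
    (ℚᵘP.≤-respʳ-≃ (ℚᵘP.≃-sym (ℚP.toℚᵘ-fromℚᵘ (ℚᵘ.mkℚᵘ (+ 1) m)))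
      (ℚᵘ.*≤* (ℤP.*-monoˡ-≤-nonNeg (+ 1) (ℤ.+≤+ (ℕ.s≤s m≤n))))))

1/suc-partialFractions : ∀ m → 1/suc m * (1ℚ - 1/suc (suc m)) ≡ 1/suc (suc m)
1/suc-partialFractions m = begin
    x * (1ℚ - y)
  ≡⟨ cong (λ e → x * (e - y)) (sym [m+2]/[m+2]≡1) ⟩
    x * ((1ℚ + m+1) * y - y)
  ≡⟨ solve 3 (λ x m+1 y → x :* ((:con 1ℚ :+ m+1) :* y :- y) := y :* (m+1 :* x)) refl x m+1 y ⟩
    y * (m+1 * x)
  ≡⟨ cong (y *_) (fromℕ-*-1/suc m) ⟩
    y * 1ℚ
  ≡⟨ ℚP.*-identityʳ y ⟩
    y ∎
  where
  open ≡-Reasoning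
  open +-*-Solver using (solve; _:=_; _:+_; _:*_; _:-_) renaming (con to :con)
  x = 1/suc m
  y = 1/suc (suc m)
  m+1 = fromℕ (suc m)
  [m+2]/[m+2]≡1 : (1ℚ + m+1) * y ≡ 1ℚ
  [m+2]/[m+2]≡1 = trans (cong (_* y) (sym (fromℕ-homo-+ 1 (suc m)))) (fromℕ-*-1/suc (suc m))

fromℕ-*-1/suc≤1 : ∀ m → fromℕ m * 1/suc m ≤ 1ℚ
fromℕ-*-1/suc≤1 m = begin
    fromℕ m * 1/suc m
  ≤⟨ p≤p+q (1/suc-nonNeg m) ⟩
    fromℕ m * 1/suc m + 1/suc m
  ≡⟨ solve 2 (λ a w → a :* w :+ w := (:con 1ℚ :+ a) :* w) refl (fromℕ m) (1/suc m) ⟩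
    (1ℚ + fromℕ m) * 1/suc m
  ≡⟨ trans (cong (_* 1/suc m) (sym (fromℕ-homo-+ 1 m))) (fromℕ-*-1/suc m) ⟩
    1ℚ ∎
  where
  open ℚP.≤-Reasoning
  open +-*-Solver using (solve; _:=_; _:+_; _:*_) renaming (con to :con)

infix 4 0≤_≤_
0≤_≤_ : ℚ → ℚ → Set
0≤ x ≤ X = 0ℚ ≤ x × x ≤ X

+-mono-0≤≤ : ∀ {x X y Y} → 0≤ x ≤ X → 0≤ y ≤ Y → 0≤ x + y ≤ X + Y
+-mono-0≤≤ (0≤x , x≤X) (0≤y , y≤Y) = ℚP.+-mono-≤ 0≤x 0≤y , ℚP.+-mono-≤ x≤X y≤Y

*-mono-0≤≤ : ∀ {x X y Y} → 0≤ x ≤ X → 0≤ y ≤ Y → 0≤ x * y ≤ X * Y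
*-mono-0≤≤ {x} {X} {y} {Y} (0≤x , x≤X) (0≤y , y≤Y) =
  ℚP.≤-trans (ℚP.≤-reflexive (sym (ℚP.*-zeroˡ y))) (ℚP.*-monoʳ-≤-nonNeg y {{0≤y′}} 0≤x) ,
  ℚP.≤-trans (ℚP.*-monoʳ-≤-nonNeg y {{0≤y′}} x≤X)
             (ℚP.*-monoˡ-≤-nonNeg X {{Q.nonNegative (ℚP.≤-trans 0≤x x≤X)}} y≤Y)
  where
  0≤y′ = Q.nonNegative 0≤y

^ℚ-0≤≤1 : ∀ {w} a → 0≤ w ≤ 1ℚ → 0≤ w ^ℚ a ≤ 1ℚ
^ℚ-0≤≤1 zero    _   = ℚP.nonNegative⁻¹ 1ℚ , ℚP.≤-refl
^ℚ-0≤≤1 (suc a) w≤1 = *-mono-0≤≤ w≤1 (^ℚ-0≤≤1 a w≤1)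

1/suc-0≤≤1 : ∀ m → 0≤ 1/suc m ≤ 1ℚ
1/suc-0≤≤1 m = 1/suc-nonNeg m , 1/suc-antitone {0} {m} ℕ.z≤n

H-suc : ∀ α m → H[ α ] (suc m) ≡ H[ α ] m + 1/suc m ^ℚ α
H-suc α m = cong (λ e → H[ α ] m + e) (1/ℕ-homo-^ (suc m) α)

H-nonNeg : ∀ α m → 0ℚ ≤ H[ α ] m
H-nonNeg α zero    = ℚP.≤-refl
H-nonNeg α (suc m) = ℚP.≤-trans (ℚP.+-mono-≤ (H-nonNeg α m) (proj₁ (^ℚ-0≤≤1 α (1/suc-0≤≤1 m))))
                                (ℚP.≤-reflexive (sym (H-suc α m)))

H[suc]≤H : ∀ α m → H[ suc α ] m ≤ H m
H[suc]≤H α zero    = ℚP.≤-refl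
H[suc]≤H α (suc m) = begin
    H[ suc α ] (suc m)               ≡⟨ H-suc (suc α) m ⟩
    H[ suc α ] m + 1/suc m ^ℚ suc α  ≤⟨ ℚP.+-mono-≤ (H[suc]≤H α m) 1/suc^[1+α]≤1/suc ⟩
    H m + 1/suc m * 1ℚ               ≡⟨ H-suc 1 m ⟨
    H (suc m)                        ∎
  where
  open ℚP.≤-Reasoning
  1/suc^[1+α]≤1/suc : 1/suc m ^ℚ suc α ≤ 1/suc m * 1ℚ
  1/suc^[1+α]≤1/suc = ℚP.*-monoˡ-≤-nonNeg (1/suc m) {{Q.nonNegative (1/suc-nonNeg m)}}
                        (proj₂ (^ℚ-0≤≤1 α (1/suc-0≤≤1 m)))

H-+-≤ : ∀ k m → H (k ℕ.+ m) ≤ H m + fromℕ k * 1/suc m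
H-+-≤ zero    m = ℚP.≤-reflexive
  (sym (trans (cong (λ e → H m + e) (ℚP.*-zeroˡ (1/suc m))) (ℚP.+-identityʳ (H m))))
H-+-≤ (suc k) m = begin
    H (suc k ℕ.+ m)
  ≡⟨ H-suc 1 (k ℕ.+ m) ⟩
    H (k ℕ.+ m) + 1/suc (k ℕ.+ m) * 1ℚ
  ≤⟨ ℚP.+-mono-≤ (H-+-≤ k m) (ℚP.*-monoʳ-≤-nonNeg 1ℚ (1/suc-antitone (ℕP.m≤n+m m k))) ⟩
    H m + fromℕ k * 1/suc m + 1/suc m * 1ℚ
  ≡⟨ solve 4 (λ h k w o → h :+ k :* w :+ w :* o := h :+ (o :+ k) :* w) refl (H m) (fromℕ k) (1/suc m) 1ℚ ⟩
    H m + (1ℚ + fromℕ k) * 1/suc m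
  ≡⟨ cong (λ e → H m + e * 1/suc m) (fromℕ-homo-+ 1 k) ⟨
    H m + fromℕ (suc k) * 1/suc m ∎
  where
  open ℚP.≤-Reasoning
  open +-*-Solver using (solve; _:=_; _:+_; _:*_)

-- Cauchy condensation: each block of 2^j further terms of the harmonic series adds at most 1.
H-2^≤ : ∀ j → H (2 ^ j) ≤ fromℕ (suc j)
H-2^≤ zero    = ℚP.≤-refl
H-2^≤ (suc j) = begin
    H (2 ^ suc j)                     ≡⟨ cong (λ e → H (2 ^ j ℕ.+ e)) (ℕP.+-identityʳ (2 ^ j)) ⟩
    H (2 ^ j ℕ.+ 2 ^ j)               ≤⟨ H-+-≤ (2 ^ j) (2 ^ j) ⟩
    H (2 ^ j) + fromℕ (2 ^ j) * 1/suc (2 ^ j)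
                                      ≤⟨ ℚP.+-mono-≤ (H-2^≤ j) (fromℕ-*-1/suc≤1 (2 ^ j)) ⟩
    fromℕ (suc j) + 1ℚ                ≡⟨ ℚP.+-comm (fromℕ (suc j)) 1ℚ ⟩
    1ℚ + fromℕ (suc j)                ≡⟨ fromℕ-homo-+ 1 (suc j) ⟨
    fromℕ (suc (suc j))               ∎
  where open ℚP.≤-Reasoning

infixl 6 _⊕_
infixl 7 _⊗_

data Poly (n : ℕ) : Set where
  lit     : ℕ → Poly n
  var     : Fin n → Poly n
  _⊕_ _⊗_ : Poly n → Poly n → Poly n

-- Besides ℚ and ℕ, also instantiated at the syntax of the ring solvers, so that identities
-- between values of ⟦_⟧ are proved by solve.
evalWith : {A : Set} → (ℕ → A) → (A → A → A) → (A → A → A) → Poly n → (Fin n → A) → A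
evalWith ι _+′_ _*′_ (lit c) ρ = ι c
evalWith ι _+′_ _*′_ (var i) ρ = ρ i
evalWith ι _+′_ _*′_ (p ⊕ q) ρ = evalWith ι _+′_ _*′_ p ρ +′ evalWith ι _+′_ _*′_ q ρ
evalWith ι _+′_ _*′_ (p ⊗ q) ρ = evalWith ι _+′_ _*′_ p ρ *′ evalWith ι _+′_ _*′_ q ρ

⟦_⟧ : Poly n → (Fin n → ℚ) → ℚ
⟦_⟧ = evalWith fromℕ _+_ _*_

⟦_⟧ℕ : Poly n → (Fin n → ℕ) → ℕ
⟦_⟧ℕ = evalWith id ℕ._+_ ℕ._*_

⟦⟧-cong : ∀ (p : Poly n) {ρ σ} → (∀ i → ρ i ≡ σ i) → ⟦ p ⟧ ρ ≡ ⟦ p ⟧ σ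
⟦⟧-cong (lit c) ρ≗σ = refl
⟦⟧-cong (var i) ρ≗σ = ρ≗σ i
⟦⟧-cong (p ⊕ q) ρ≗σ = cong₂ _+_ (⟦⟧-cong p ρ≗σ) (⟦⟧-cong q ρ≗σ)
⟦⟧-cong (p ⊗ q) ρ≗σ = cong₂ _*_ (⟦⟧-cong p ρ≗σ) (⟦⟧-cong q ρ≗σ)

⟦⟧-fromℕ : ∀ (p : Poly n) ρ → ⟦ p ⟧ (fromℕ ∘ ρ) ≡ fromℕ (⟦ p ⟧ℕ ρ)
⟦⟧-fromℕ (lit c) ρ = refl
⟦⟧-fromℕ (var i) ρ = refl
⟦⟧-fromℕ (p ⊕ q) ρ = trans (cong₂ _+_ (⟦⟧-fromℕ p ρ) (⟦⟧-fromℕ q ρ))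
                           (sym (fromℕ-homo-+ (⟦ p ⟧ℕ ρ) (⟦ q ⟧ℕ ρ)))
⟦⟧-fromℕ (p ⊗ q) ρ = trans (cong₂ _*_ (⟦⟧-fromℕ p ρ) (⟦⟧-fromℕ q ρ))
                           (sym (fromℕ-homo-* (⟦ p ⟧ℕ ρ) (⟦ q ⟧ℕ ρ)))

⟦⟧-mono : ∀ (p : Poly n) {ρ σ} → (∀ i → 0≤ ρ i ≤ σ i) → 0≤ ⟦ p ⟧ ρ ≤ ⟦ p ⟧ σ
⟦⟧-mono (lit c) ρ≤σ = ℚP.nonNegative⁻¹ (fromℕ c) {{ℚP.normalize-nonNeg c 1}} , ℚP.≤-refl
⟦⟧-mono (var i) ρ≤σ = ρ≤σ i
⟦⟧-mono (p ⊕ q) ρ≤σ = +-mono-0≤≤ (⟦⟧-mono p ρ≤σ) (⟦⟧-mono q ρ≤σ)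
⟦⟧-mono (p ⊗ q) ρ≤σ = *-mono-0≤≤ (⟦⟧-mono p ρ≤σ) (⟦⟧-mono q ρ≤σ)

harmonics : ℕ → Fin n → ℚ
harmonics m i = H[ suc (toℕ i) ] m

-- Appending w to the list x₁, …, x_m adds w^k to its k-th power sum.
shift : ℚ → (Fin n → ℚ) → Fin n → ℚ
shift w ρ i = ρ i + w ^ℚ suc (toℕ i)

harmonics-suc : ∀ m (i : Fin n) → harmonics (suc m) i ≡ shift (1/suc m) (harmonics m) i
harmonics-suc m i = H-suc (suc (toℕ i)) m

h₁ h₂ h₃ h₄ : Poly 4
h₁ = var zero
h₂ = var (suc zero)
h₃ = var (suc (suc zero))
h₄ = var (suc (suc (suc zero)))

-- At the power sums H^(1), …, H^(4) of 1, 1/2, …, 1/m these are 4! h₄ and 4! (h₀ + ⋯ + h₄).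
numer Φ : Poly 4
numer = lit 6 ⊗ h₄ ⊕ lit 8 ⊗ h₃ ⊗ h₁ ⊕ lit 3 ⊗ h₂ ⊗ h₂ ⊕ lit 6 ⊗ h₁ ⊗ h₁ ⊗ h₂ ⊕ h₁ ⊗ h₁ ⊗ h₁ ⊗ h₁
Φ = lit 24 ⊕ lit 24 ⊗ h₁ ⊕ lit 12 ⊗ h₁ ⊗ h₁ ⊕ lit 12 ⊗ h₂ ⊕ lit 4 ⊗ h₁ ⊗ h₁ ⊗ h₁
  ⊕ lit 12 ⊗ h₁ ⊗ h₂ ⊕ lit 8 ⊗ h₃ ⊕ numer

Φ-telescopes : ∀ w ρ → ⟦ Φ ⟧ ρ ≡ ⟦ Φ ⟧ (shift w ρ) - w * (⟦ Φ ⟧ (shift w ρ) - ⟦ numer ⟧ (shift w ρ))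
Φ-telescopes w ρ = solve 5
  (λ a b c d x → let σ  = a ∷ b ∷ c ∷ d ∷ []
                     σ′ = λ i → σ i :+ x :^ suc (toℕ i)
                 in ⟦ Φ ⟧ˢ σ := ⟦ Φ ⟧ˢ σ′ :- x :* (⟦ Φ ⟧ˢ σ′ :- ⟦ numer ⟧ˢ σ′))
  refl (ρ zero) (ρ (suc zero)) (ρ (suc (suc zero))) (ρ (suc (suc (suc zero)))) w
  where
  open +-*-Solver using (Polynomial; solve; _:=_; _:+_; _:*_; _:-_; _:^_) renaming (con to :con)
  ⟦_⟧ˢ : ∀ {k} → Poly 4 → (Fin 4 → Polynomial k) → Polynomial k
  ⟦_⟧ˢ = evalWith (:con ∘ fromℕ) _:+_ _:*_

Φ-harmonics-step : ∀ m → let Φ′ = ⟦ Φ ⟧ (harmonics (suc m)) in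
  ⟦ Φ ⟧ (harmonics m) ≡ Φ′ - 1/suc m * (Φ′ - ⟦ numer ⟧ (harmonics (suc m)))
Φ-harmonics-step m = trans (Φ-telescopes (1/suc m) (harmonics m))
  (cong₂ (λ φ ν → φ - 1/suc m * (φ - ν))
         (⟦⟧-cong Φ shift≗harmonics) (⟦⟧-cong numer shift≗harmonics))
  where
  shift≗harmonics : ∀ i → shift (1/suc m) (harmonics m) i ≡ harmonics (suc m) i
  shift≗harmonics i = sym (harmonics-suc m i)

term-factorises : ∀ k → term k ≡ ⟦ numer ⟧ (harmonics (suc (suc k))) * (1/suc k * 1/suc (suc k))
term-factorises k = begin
    term k
  ≡⟨⟩
    ⟦ numer ⟧ (harmonics (suc k ℕ.+ 1)) * 1/ℕ (suc k ℕ.* (suc k ℕ.+ 1))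
  ≡⟨ cong₂ _*_ (cong (⟦ numer ⟧ ∘ harmonics) [1+k]+1≡2+k) (1/ℕ-cong (cong (suc k ℕ.*_) [1+k]+1≡2+k)) ⟩
    ⟦ numer ⟧ (harmonics (suc (suc k))) * 1/ℕ (suc k ℕ.* suc (suc k))
  ≡⟨ cong (⟦ numer ⟧ (harmonics (suc (suc k))) *_) (1/ℕ-homo-* (suc k) (suc (suc k))) ⟩
    ⟦ numer ⟧ (harmonics (suc (suc k))) * (1/suc k * 1/suc (suc k)) ∎
  where
  open ≡-Reasoning
  [1+k]+1≡2+k : suc k ℕ.+ 1 ≡ suc (suc k)
  [1+k]+1≡2+k = cong suc (ℕP.+-comm k 1)

tail : ℕ → ℚ
tail N = ⟦ Φ ⟧ (harmonics (suc N)) * 1/suc N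

S-closed : ∀ N → S N ≡ fromℕ 120 - tail N
S-closed zero    = refl
S-closed (suc N) = begin
    S N + term N
  ≡⟨ cong₂ _+_ (S-closed N) (term-factorises N) ⟩
    c - ⟦ Φ ⟧ (harmonics (suc N)) * x + ν * (x * y)
  ≡⟨ cong (λ φ → c - φ * x + ν * (x * y)) (Φ-harmonics-step (suc N)) ⟩
    c - (φ - y * (φ - ν)) * x + ν * (x * y)
  ≡⟨ solve 5 (λ c φ ν x y → c :- (φ :- y :* (φ :- ν)) :* x :+ ν :* (x :* y)
                         := c :- φ :* (x :* (:con 1ℚ :- y)))
             refl c φ ν x y ⟩
    c - φ * (x * (1ℚ - y))
  ≡⟨ cong (λ e → c - φ * e) (1/suc-partialFractions N) ⟩
    c - φ * y ∎
  where
  open ≡-Reasoning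
  open +-*-Solver using (solve; _:=_; _:+_; _:*_; _:-_) renaming (con to :con)
  c = fromℕ 120
  φ = ⟦ Φ ⟧ (harmonics (suc (suc N)))
  ν = ⟦ numer ⟧ (harmonics (suc (suc N)))
  x = 1/suc N
  y = 1/suc (suc N)

harmonics-0≤≤ : ∀ {B} m → H m ≤ B → ∀ (i : Fin n) → 0≤ harmonics m i ≤ B
harmonics-0≤≤ m H≤B i = H-nonNeg (suc (toℕ i)) m , ℚP.≤-trans (H[suc]≤H (toℕ i) m) H≤B

term-nonNeg : ∀ k → 0ℚ ≤ term k
term-nonNeg k = subst (0ℚ ≤_) (sym (term-factorises k))
  (proj₁ (*-mono-0≤≤ (⟦⟧-mono numer (harmonics-0≤≤ (suc (suc k)) ℚP.≤-refl))
                     (*-mono-0≤≤ (1/suc-0≤≤1 k) (1/suc-0≤≤1 (suc k)))))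

S-mono : ∀ {N n} → N ≤ℕ n → S N ≤ S n
S-mono = S-mono′ ∘ ℕP.≤⇒≤′
  where
  S-mono′ : ∀ {N n} → N ℕ.≤′ n → S N ≤ S n
  S-mono′ (ℕ.≤′-reflexive refl)  = ℚP.≤-refl
  S-mono′ (ℕ.≤′-step {n} N≤′n) = ℚP.≤-trans (S-mono′ N≤′n) (p≤p+q (term-nonNeg n))

tail≡120-S : ∀ N → tail N ≡ fromℕ 120 - S N
tail≡120-S N = trans (solve 2 (λ c t → t := c :- (c :- t)) refl (fromℕ 120) (tail N))
                     (cong (fromℕ 120 -_) (sym (S-closed N)))
  where open +-*-Solver using (solve; _:=_; _:-_)

tail-antitone : ∀ {N n} → N ≤ℕ n → tail n ≤ tail N
tail-antitone {N} {n} N≤n = begin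
  tail n           ≡⟨ tail≡120-S n ⟩
  fromℕ 120 - S n  ≤⟨ ℚP.+-mono-≤ (ℚP.≤-refl {fromℕ 120}) (ℚP.neg-antimono-≤ (S-mono N≤n)) ⟩
  fromℕ 120 - S N  ≡⟨ tail≡120-S N ⟨
  tail N           ∎
  where open ℚP.≤-Reasoning

tail-nonNeg : ∀ N → 0ℚ ≤ tail N
tail-nonNeg N = proj₁ (*-mono-0≤≤ (⟦⟧-mono Φ (harmonics-0≤≤ (suc N) ℚP.≤-refl)) (1/suc-0≤≤1 N))

∣S-120∣≡tail : ∀ N → ∣ S N - fromℕ 120 ∣ ≡ tail N
∣S-120∣≡tail N = begin
  ∣ S N - fromℕ 120 ∣                 ≡⟨ cong (λ s → ∣ s - fromℕ 120 ∣) (S-closed N) ⟩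
  ∣ fromℕ 120 - tail N - fromℕ 120 ∣  ≡⟨ cong ∣_∣ (solve 2 (λ c t → c :- t :- c := :- t) refl (fromℕ 120) (tail N)) ⟩
  ∣ Q.- tail N ∣                      ≡⟨ ℚP.∣-p∣≡∣p∣ (tail N) ⟩
  ∣ tail N ∣                          ≡⟨ ℚP.0≤p⇒∣p∣≡p (tail-nonNeg N) ⟩
  tail N                              ∎
  where
  open ≡-Reasoning
  open +-*-Solver using (solve; _:=_; _:-_; :-_)

tail≤ : ∀ N b → H (suc N) ≤ fromℕ b → tail N ≤ fromℕ (⟦ Φ ⟧ℕ (λ _ → b)) * 1/suc N
tail≤ N b H≤b = begin
  tail N                              ≤⟨ ℚP.*-monoʳ-≤-nonNeg (1/suc N) {{0≤1/suc}} Φ≤Φ[b] ⟩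
  ⟦ Φ ⟧ (λ _ → fromℕ b) * 1/suc N     ≡⟨ cong (_* 1/suc N) (⟦⟧-fromℕ Φ (λ _ → b)) ⟩
  fromℕ (⟦ Φ ⟧ℕ (λ _ → b)) * 1/suc N  ∎
  where
  open ℚP.≤-Reasoning
  0≤1/suc = Q.nonNegative (1/suc-nonNeg N)
  Φ≤Φ[b] : ⟦ Φ ⟧ (harmonics (suc N)) ≤ ⟦ Φ ⟧ (λ _ → fromℕ b)
  Φ≤Φ[b] = proj₂ (⟦⟧-mono Φ (harmonics-0≤≤ (suc N) H≤b))

positive⇒1/suc≤ : ∀ ε → 0ℚ < ε → ∃ λ q → 1/suc q ≤ ε
positive⇒1/suc≤ (mkℚ (+ zero)    _ _) (Q.*<* (ℤ.+<+ ()))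
positive⇒1/suc≤ (mkℚ ℤ.-[1+ _ ]  _ _) (Q.*<* ())
positive⇒1/suc≤ (mkℚ (+ suc p)   q _) _ = q , ℚP.toℚᵘ-cancel-≤
  (ℚᵘP.≤-respˡ-≃ (ℚᵘP.≃-sym (ℚP.toℚᵘ-fromℚᵘ (ℚᵘ.mkℚᵘ (+ 1) q)))
    (ℚᵘ.*≤* (ℤP.*-monoʳ-≤-nonNeg (+ suc q) (ℤ.+≤+ (ℕ.s≤s (ℕ.z≤n {p}))))))

fromℕ-*-1/suc<1/suc : ∀ a N q → a ℕ.* suc q ℕ.< suc N → fromℕ a * 1/suc N < 1/suc q
fromℕ-*-1/suc<1/suc a N q a[1+q]<1+N = ℚP.toℚᵘ-cancel-<
  (ℚᵘP.<-respˡ-≃ (ℚᵘP.≃-sym lhs≃) (ℚᵘP.<-respʳ-≃ (ℚᵘP.≃-sym (ℚP.toℚᵘ-fromℚᵘ 1/[1+q]))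
    (ℚᵘ.*<* (subst₂ ℤ._<_ lhs≡ rhs≡ (ℤ.+<+ a[1+q]<1+N)))))
  where
  a/1 = ℚᵘ.mkℚᵘ (+ a) 0
  1/[1+N] = ℚᵘ.mkℚᵘ (+ 1) N
  1/[1+q] = ℚᵘ.mkℚᵘ (+ 1) q
  lhs≃ : toℚᵘ (fromℕ a * 1/suc N) ℚᵘ.≃ a/1 ℚᵘ.* 1/[1+N]
  lhs≃ = ℚᵘP.≃-trans (ℚP.toℚᵘ-cong (sym (fromℚᵘ-homo-* a/1 1/[1+N])))
                     (ℚP.toℚᵘ-fromℚᵘ (a/1 ℚᵘ.* 1/[1+N]))
  lhs≡ : + (a ℕ.* suc q) ≡ (+ a ℤ.* + 1) ℤ.* + suc q
  lhs≡ = trans (ℤP.pos-* a (suc q)) (cong (ℤ._* + suc q) (sym (ℤP.*-identityʳ (+ a))))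
  rhs≡ : + suc N ≡ + 1 ℤ.* + suc (N ℕ.+ 0)
  rhs≡ = trans (cong (λ m → + suc m) (sym (ℕP.+-identityʳ N))) (sym (ℤP.*-identityˡ _))

n<2^n : ∀ n → n ℕ.< 2 ^ n
n<2^n zero    = ℕ.s≤s ℕ.z≤n
n<2^n (suc n) = ℕP.≤-trans (ℕP.+-mono-≤ (ℕP.m^n>0 2 n) (n<2^n n))
                           (ℕP.≤-reflexive (cong (2 ^ n ℕ.+_) (sym (ℕP.+-identityʳ (2 ^ n)))))

⟦Φ⟧ℕ-const≤ : ∀ x → ⟦ Φ ⟧ℕ (λ _ → suc x) ≤ℕ 120 ℕ.* suc x ^ 4
⟦Φ⟧ℕ-const≤ x = ℕP.≤-trans (ℕP.m≤m+n (⟦ Φ ⟧ℕ (λ _ → suc x)) slack) (ℕP.≤-reflexive (solve 1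
  (λ x → let b = con 1 :+ x in
    evalWith con _:+_ _:*_ Φ (λ _ → b)
      :+ (con 326 :* x :+ con 649 :* x :^ 2 :+ con 466 :* x :^ 3 :+ con 119 :* x :^ 4)
    := con 120 :* b :^ 4)
  refl x))
  where
  open ℕS.+-*-Solver using (solve; _:=_; _:+_; _:*_; _:^_; con)
  slack = 326 ℕ.* x ℕ.+ 649 ℕ.* x ^ 2 ℕ.+ 466 ℕ.* x ^ 3 ℕ.+ 119 ℕ.* x ^ 4

-- 491520 = 120 · 8⁴, so that with X = 2^t the bound below is t X⁴ < X⁵.
⟦Φ⟧ℕ-const<2^ : ∀ q → let t = 491520 ℕ.* q in ⟦ Φ ⟧ℕ (λ _ → suc (t ℕ.* 8)) ℕ.* q ℕ.< 2 ^ (t ℕ.* 8)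
⟦Φ⟧ℕ-const<2^ q = begin-strict
    ⟦ Φ ⟧ℕ (λ _ → b) ℕ.* q      ≤⟨ ℕP.*-monoˡ-≤ q (⟦Φ⟧ℕ-const≤ (t ℕ.* 8)) ⟩
    120 ℕ.* b ^ 4 ℕ.* q         ≤⟨ ℕP.*-monoˡ-≤ q (ℕP.*-monoʳ-≤ 120 (ℕP.^-monoˡ-≤ 4 b≤8X)) ⟩
    120 ℕ.* (X ℕ.* 8) ^ 4 ℕ.* q ≡⟨ solve 2 (λ X q → con 120 :* (X :* con 8) :^ 4 :* q
                                                  := con 491520 :* q :* X :^ 4) refl X q ⟩
    t ℕ.* X ^ 4                 <⟨ ℕP.*-monoˡ-< (X ^ 4) {{ℕP.m^n≢0 X 4 {{X≢0}}}} (n<2^n t) ⟩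
    X ^ 5                       ≤⟨ ℕP.^-monoʳ-≤ X {{X≢0}} {5} {8} (ℕP.m≤m+n 5 3) ⟩
    X ^ 8                       ≡⟨ ℕP.^-*-assoc 2 t 8 ⟩
    2 ^ (t ℕ.* 8)               ∎
  where
  open ℕP.≤-Reasoning
  open ℕS.+-*-Solver using (solve; _:=_; _:*_; _:^_; con)
  t = 491520 ℕ.* q
  X = 2 ^ t
  X≢0 : NonZero X
  X≢0 = ℕP.m^n≢0 2 t
  b = suc (t ℕ.* 8)
  b≤8X : b ≤ℕ X ℕ.* 8
  b≤8X = ℕP.≤-trans (ℕ.s≤s (ℕP.m≤n+m (t ℕ.* 8) 7)) (ℕP.*-monoˡ-≤ 8 (n<2^n t))

tail-small : ∀ q N → suc N ≡ 2 ^ (491520 ℕ.* suc q ℕ.* 8) → tail N < 1/suc q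
tail-small q N 1+N≡2^j = begin-strict
  tail N               ≤⟨ tail≤ N (suc j) (subst (λ m → H m ≤ fromℕ (suc j)) (sym 1+N≡2^j) (H-2^≤ j)) ⟩
  fromℕ A * 1/suc N    <⟨ fromℕ-*-1/suc<1/suc A N q
                            (subst (A ℕ.* suc q ℕ.<_) (sym 1+N≡2^j) (⟦Φ⟧ℕ-const<2^ (suc q))) ⟩
  1/suc q              ∎
  where
  open ℚP.≤-Reasoning
  j = 491520 ℕ.* suc q ℕ.* 8
  A = ⟦ Φ ⟧ℕ (λ _ → suc j)

mainTheorem7 : (ε : ℚ) → 0ℚ < ε →
    ∃ λ (N : ℕ) → (n : ℕ) → N ≤ℕ n → ∣ S n - (+ 120 / 1) ∣ < ε
mainTheorem7 ε 0<ε with positive⇒1/suc≤ ε 0<ε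
... | q , 1/suc-q≤ε = N , λ n N≤n → begin-strict
    ∣ S n - fromℕ 120 ∣  ≡⟨ ∣S-120∣≡tail n ⟩
    tail n               ≤⟨ tail-antitone N≤n ⟩
    tail N               <⟨ tail-small q N 1+N≡2^j ⟩
    1/suc q              ≤⟨ 1/suc-q≤ε ⟩
    ε                    ∎
  where
  open ℚP.≤-Reasoning
  j = 491520 ℕ.* suc q ℕ.* 8
  N = ℕ.pred (2 ^ j)
  1+N≡2^j : suc N ≡ 2 ^ j
  1+N≡2^j = ℕP.suc-pred (2 ^ j) {{ℕP.m^n≢0 2 j}}
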